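{- Let $\mathcal{C}\subseteq\mathbb{F}_q^{k\times m}$ be a dually QMRD code. Then $\rho(\mathcal{C})\le d(\mathcal{C})$, and equality holds if and only if $\mathcal{C}$ is not maximal.
   Context: $q$ prime power, $k\le m$ positive integers. A linear code is an $\mathbb{F}_q$-subspace of $\mathbb{F}_q^{k\times m}$, with dual $\mathcal{C}^\perp=\{N:\mathrm{Tr}(MN^t)=0\ \forall M\in\mathcal{C}\}$; $d(\cdot)$ denotes minimum rank distance, $d(M,N)=\mathrm{rk}(M-N)$ (for linear codes, the minimum rank of a nonzero element). The covering radius is $\rho(\mathcal{C})=\min\{i:\forall X\in\mathbb{F}_q^{k\times m}\ \exists M\in\mathcal{C},\ d(X,M)\le i\}$. A linear code $\mathcal{C}$ is dually QMRD if $m\nmid\dim(\mathcal{C})$, $d(\mathcal{C})=k-\lceil\dim(\mathcal{C})/m\rceil+1$ and $d(\mathcal{C}^\perp)=k-\lceil\dim(\mathcal{C}^\perp)/m\rceil+1$. A code $\mathcal{C}$ with $|\mathcal{C}|\ge2$ is maximal if there is no code $\mathcal{D}\supsetneq\mathcal{C}$ in $\mathbb{F}_q^{k\times m}$ with $d(\mathcal{D})=d(\mathcal{C})$. -}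

module Defs where

open import Level using (0ℓ)
open import Algebra.Bundles using (CommutativeRing)
open import Data.Nat using (ℕ; zero; suc; _^_; _≤_; NonZero)
import Data.Nat as ℕ
open import Data.Nat.Primality using (Prime)
import Data.Nat.Divisibility
import Data.Product
open import Data.Fin using (Fin)
open import Data.Product using (Σ; ∃; _×_; _,_)
open import Relation.Nullary using (¬_)
open import Relation.Binary.PropositionalEquality using (_≡_)
open import Function using (_∘_)
open import Function.Definitions using (Injective)

IsPrimePower : ℕ → Set
IsPrimePower q = Σ ℕ λ p → Σ ℕ λ e → Prime p × q ≡ p ^ suc e

⌈_/_⌉ : (n m : ℕ) → .{{NonZero m}} → ℕ
⌈ n / m ⌉ = (n ℕ.+ (m ℕ.∸ 1)) ℕ./ m

record FiniteField (q : ℕ) : Set₁ where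
  field
    cring : CommutativeRing 0ℓ 0ℓ
  open CommutativeRing cring public
  field
    0≉1      : ¬ (0# ≈ 1#)
    inverse  : ∀ x → ¬ (x ≈ 0#) → ∃ λ y → (x * y) ≈ 1#
    enum     : Fin q → Carrier
    enum-inj : ∀ i j → enum i ≈ enum j → i ≡ j
    enum-sur : ∀ x → ∃ λ i → enum i ≈ x

module Codes {q : ℕ} (F : FiniteField q) where
  open FiniteField F
  open import Algebra.Properties.Monoid.Sum +-monoid using (sum)

  Mat : ℕ → ℕ → Set
  Mat k m = Fin k → Fin m → Carrier

  lincomb : ∀ {I : Set} {r} → (Fin r → Carrier) → (Fin r → I → Carrier) → I → Carrier
  lincomb c v x = sum (λ i → c i * v i x)

  LinIndep : ∀ {I : Set} {r} → (Fin r → I → Carrier) → Set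
  LinIndep {I} {r} v = ∀ (c : Fin r → Carrier) → (∀ x → lincomb c v x ≈ 0#) → ∀ i → c i ≈ 0#

  IsRank : ∀ {k m} → Mat k m → ℕ → Set
  IsRank {k} {m} M r =
    (Σ (Fin r → Fin k) λ s → Injective _≡_ _≡_ s × LinIndep (M ∘ s)) ×
    (∀ r' (s : Fin r' → Fin k) → Injective _≡_ _≡_ s → LinIndep (M ∘ s) → r' ≤ r)

  _≈ₘ_ : ∀ {k m} → Mat k m → Mat k m → Set
  M ≈ₘ N = ∀ i j → M i j ≈ N i j

  _-ₘ_ : ∀ {k m} → Mat k m → Mat k m → Mat k m
  (M -ₘ N) i j = M i j - N i j

  _+ₘ_ : ∀ {k m} → Mat k m → Mat k m → Mat k m
  (M +ₘ N) i j = M i j + N i j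

  _·ₘ_ : ∀ {k m} → Carrier → Mat k m → Mat k m
  (a ·ₘ M) i j = a * M i j

  0ₘ : ∀ {k m} → Mat k m
  0ₘ i j = 0#

  IsDist : ∀ {k m} → Mat k m → Mat k m → ℕ → Set
  IsDist M N r = IsRank (M -ₘ N) r

  Code : ℕ → ℕ → Set₁
  Code k m = Mat k m → Set

  RespectsEq : ∀ {k m} → Code k m → Set
  RespectsEq C = ∀ {M N} → M ≈ₘ N → C M → C N

  record IsLinearCode {k m} (C : Code k m) : Set where
    field
      resp  : RespectsEq C
      zero∈ : C 0ₘ
      +∈    : ∀ {M N} → C M → C N → C (M +ₘ N)
      ·∈    : ∀ a {M} → C M → C (a ·ₘ M)

  flat : ∀ {k m} → Mat k m → (Fin k × Fin m) → Carrier
  flat M (a , j) = M a j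

  IsDim : ∀ {k m} → Code k m → ℕ → Set
  IsDim {k} {m} C n =
    Σ (Fin n → Mat k m) λ b →
      (∀ i → C (b i)) ×
      LinIndep (flat ∘ b) ×
      (∀ X → C X → ∃ λ (c : Fin n → Carrier) → ∀ a j → lincomb c (flat ∘ b) (a , j) ≈ X a j)

  -- Tr(M N^t) = Σ_i Σ_j M_ij N_ij
  trMNt : ∀ {k m} → Mat k m → Mat k m → Carrier
  trMNt M N = sum (λ i → sum (λ j → M i j * N i j))

  Dual : ∀ {k m} → Code k m → Code k m
  Dual C N = ∀ M → C M → trMNt M N ≈ 0#

  MinDist : ∀ {k m} → Code k m → ℕ → Set
  MinDist C δ =
    (∃ λ M → ∃ λ N → C M × C N × ¬ (M ≈ₘ N) × IsDist M N δ) ×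
    (∀ M N → C M → C N → ¬ (M ≈ₘ N) → ∀ r → IsDist M N r → δ ≤ r)

  Covers : ∀ {k m} → Code k m → ℕ → Set
  Covers {k} {m} C i = ∀ (X : Mat k m) → ∃ λ M → C M × ∃ λ r → IsDist X M r × r ≤ i

  CovRad : ∀ {k m} → Code k m → ℕ → Set
  CovRad C ρ = Covers C ρ × (∀ i → Covers C i → ρ ≤ i)

  Maximal : ∀ {k m} → Code k m → Set₁
  Maximal {k} {m} C =
    (∃ λ M → ∃ λ N → C M × C N × ¬ (M ≈ₘ N)) ×
    ¬ (Σ (Code k m) λ D → RespectsEq D × (∀ M → C M → D M) ×
         (∃ λ X → D X × ¬ C X) ×
         (∃ λ δ → MinDist C δ × MinDist D δ))

  -- dually QMRD, with dim(C) = n and dim(C^⊥) = n'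
  DuallyQMRD : ∀ {k m} .{{_ : NonZero m}} → Code k m → ℕ → ℕ → Set
  DuallyQMRD {k} {m} C n n' =
    ¬ (Data.Nat.Divisibility._∣_ m n) ×
    MinDist C ((k ℕ.∸ ⌈ n / m ⌉) ℕ.+ 1) ×
    MinDist (Dual C) ((k ℕ.∸ ⌈ n' / m ⌉) ℕ.+ 1)

module Submission where

-- Put c = ⌈dim C / m⌉, c' = ⌈dim C⊥ / m⌉ and t = k - c', so that d(C⊥) = t + 1 > t.
--  * Covering. A nonzero dual codeword vanishing outside the top t rows would have rank ≤ t < d(C⊥).
--    Hence (Gaussian elimination) every pattern of top t rows occurs in C, so every matrix agrees
--    with a codeword on the top t rows and is within rank distance k - t of C: ρ(C) ≤ k - t.
--  * Counting. dim C + dim C⊥ ≤ km, because dual codewords together with a family dual to a basis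
--    of C are independent in F^{km}; ceiling arithmetic then gives k - t ≤ k - c + 1 = d(C).
--  * Maximality. If ρ < d, every new matrix is within ρ < d of C, so C is maximal. If ρ = d = d₀ + 1,
--    C is not covered at radius d₀; a finite search over the codewords finds a matrix at distance
--    > d₀ from all of them, and adjoining it keeps the minimum distance, so C is not maximal.

open import Defs
open import Data.Nat as ℕ using (ℕ; zero; suc; z≤n; s≤s; _≤_; _<_; NonZero)
import Data.Nat.Properties as ℕP
open import Data.Nat.DivMod using (m/n*n≤m)
open import Data.Nat.Tactic.RingSolver using (solve-∀)
open import Data.Fin as Fin using (Fin; zero; suc; punchIn)
import Data.Fin.Properties as FinP
open import Data.Vec using (Vec; []; _∷_; lookup; tabulate)
import Data.Vec.Properties as VecP
import Data.Vec.Functional as VF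
import Data.Vec.Functional.Properties as VFP
open import Data.Product using (Σ; ∃; _×_; _,_; proj₁; proj₂)
open import Data.Sum as Sum using (_⊎_; inj₁; inj₂)
open import Data.Empty using (⊥-elim)
open import Relation.Nullary using (¬_; Dec; yes; no)
open import Relation.Nullary.Decidable using (_×-dec_; _→-dec_; ¬?; decidable-stable)
open import Relation.Binary.PropositionalEquality as P using (_≡_)
open import Function using (_∘_)
open import Function.Definitions using (Injective)
open import Function.Bundles using (_⇔_; mk⇔)

module CeilingArithmetic where
  open import Data.Nat using (_+_; _*_; _∸_)
  open ℕP.≤-Reasoning

  ceil*m≤ : ∀ n m .{{_ : NonZero m}} → ⌈ n / m ⌉ * m ≤ n + (m ∸ 1)
  ceil*m≤ n m = m/n*n≤m (n + (m ∸ 1)) m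

  ceil-sum≤ : ∀ k m n n' .{{_ : NonZero m}} → n + n' ≤ k * m → ⌈ n / m ⌉ + ⌈ n' / m ⌉ ≤ suc k
  ceil-sum≤ k m@(suc m') n n' n+n'≤km = ℕP.≤-pred (ℕP.*-cancelʳ-< m _ (suc (suc k)) (begin-strict
    (⌈ n / m ⌉ + ⌈ n' / m ⌉) * m      ≡⟨ ℕP.*-distribʳ-+ m ⌈ n / m ⌉ ⌈ n' / m ⌉ ⟩
    ⌈ n / m ⌉ * m + ⌈ n' / m ⌉ * m    ≤⟨ ℕP.+-mono-≤ (ceil*m≤ n m) (ceil*m≤ n' m) ⟩
    (n + m') + (n' + m')              ≡⟨ regroup n n' m' ⟩
    (n + n') + m' + m'                ≤⟨ ℕP.+-monoˡ-≤ m' (ℕP.+-monoˡ-≤ m' n+n'≤km) ⟩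
    k * m + m' + m'                   <⟨ ℕP.m<n+m _ {2} (s≤s z≤n) ⟩
    2 + (k * m + m' + m')             ≡⟨ regroup' k m' ⟩
    suc (suc k) * m                   ∎))
    where
    regroup : ∀ n n' m' → (n + m') + (n' + m') ≡ (n + n') + m' + m'
    regroup = solve-∀
    regroup' : ∀ k m' → 2 + (k * suc m' + m' + m') ≡ suc (suc k) * suc m'
    regroup' = solve-∀

  free-rows≤ : ∀ k m n n' .{{_ : NonZero m}} → n + n' ≤ k * m →
    k ∸ (k ∸ ⌈ n' / m ⌉) ≤ k ∸ ⌈ n / m ⌉ + 1
  free-rows≤ k m n n' n+n'≤km = begin
    k ∸ (k ∸ c')   ≤⟨ ℕP.m≤n+o⇒m∸n≤o k (k ∸ c') (ℕP.≤-trans (ℕP.m≤n+m∸n k c') (ℕP.≤-reflexive (ℕP.+-comm c' (k ∸ c')))) ⟩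
    c'             ≤⟨ ℕP.m+n≤o⇒m≤o∸n c' (ℕP.≤-trans (ℕP.≤-reflexive (ℕP.+-comm c' c)) (ceil-sum≤ k m n n' n+n'≤km)) ⟩
    suc k ∸ c      ≤⟨ ℕP.m≤n+o⇒m∸n≤o (suc k) c (ℕP.≤-trans (s≤s (ℕP.m≤n+m∸n k c)) (ℕP.≤-reflexive (P.sym (ℕP.+-suc c (k ∸ c))))) ⟩
    suc (k ∸ c)    ≡⟨ ℕP.+-comm 1 (k ∸ c) ⟩
    k ∸ c + 1      ∎
    where
    c  = ⌈ n / m ⌉
    c' = ⌈ n' / m ⌉

module LinearAlgebra {q : ℕ} (F : FiniteField q) where
  open FiniteField F hiding (zero)
  open Codes F
  open import Algebra.Properties.CommutativeMonoid.Sum +-commutativeMonoid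
    using (sum; sum-cong-≋; sum-cong-≗; ∑-distrib-+; ∑-comm; sum-remove; sum-replicate-zero)
  open import Algebra.Properties.Semiring.Sum semiring using (*-distribˡ-sum; *-distribʳ-sum)
  open import Algebra.Properties.Ring ring
    using (-‿distribˡ-*; -‿distribʳ-*; -‿injective; -0#≈0#; x≈y⇒x∙y⁻¹≈ε; ⁻¹-anti-homo‿-; //-rightDividesˡ; [y-z]x≈yx-zx)
  open import Relation.Binary.Reasoning.Setoid setoid

  V : ℕ → Set
  V N = Fin N → Carrier

  -- Equality in F is decidable because F is finite.
  _≟F_ : ∀ x y → Dec (x ≈ y)
  x ≟F y with enum-sur x | enum-sur y
  ... | i , ei | j , ej with i FinP.≟ j
  ... | yes P.refl = yes (trans (sym ei) ej)
  ... | no i≢j = no λ x≈y → i≢j (enum-inj i j (trans ei (trans x≈y (sym ej))))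

  1≉0 : ¬ (1# ≈ 0#)
  1≉0 e = 0≉1 (sym e)

  sum-zero : ∀ {n} {f : V n} → (∀ i → f i ≈ 0#) → sum f ≈ 0#
  sum-zero {n} f≈0 = trans (sum-cong-≋ f≈0) (sum-replicate-zero n)

  sum-sub-scaled : ∀ {n} (a A B : V n) W →
    sum (λ i → a i * (A i - B i * W)) ≈ sum (λ i → a i * A i) - sum (λ i → a i * B i) * W
  sum-sub-scaled a A B W = begin
    sum (λ i → a i * (A i - B i * W))          ≈⟨ sum-cong-≋ (λ i → trans (distribˡ (a i) (A i) _) (+-congˡ (term i))) ⟩
    sum (λ i → a i * A i + a i * B i * - W)    ≈⟨ ∑-distrib-+ (λ i → a i * A i) (λ i → a i * B i * - W) ⟩
    sum (λ i → a i * A i) + sum (λ i → a i * B i * - W)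
                                               ≈⟨ +-congˡ (sym (*-distribʳ-sum (- W) (λ i → a i * B i))) ⟩
    sum (λ i → a i * A i) + sum (λ i → a i * B i) * - W
                                               ≈⟨ +-congˡ (sym (-‿distribʳ-* _ W)) ⟩
    sum (λ i → a i * A i) - sum (λ i → a i * B i) * W ∎
    where
    term : ∀ i → a i * - (B i * W) ≈ a i * B i * - W
    term i = trans (*-congˡ (-‿distribʳ-* (B i) W)) (sym (*-assoc (a i) (B i) (- W)))

  kronecker : ∀ {n} → Fin n → Fin n → Carrier
  kronecker zero    zero    = 1#
  kronecker zero    (suc i) = 0#
  kronecker (suc p) zero    = 0#
  kronecker (suc p) (suc i) = kronecker p i

  kronecker-diag : ∀ {n} (p : Fin n) → kronecker p p ≡ 1#
  kronecker-diag zero    = P.refl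
  kronecker-diag (suc p) = kronecker-diag p

  kronecker-sym : ∀ {n} (p i : Fin n) → kronecker p i ≡ kronecker i p
  kronecker-sym zero    zero    = P.refl
  kronecker-sym zero    (suc i) = P.refl
  kronecker-sym (suc p) zero    = P.refl
  kronecker-sym (suc p) (suc i) = kronecker-sym p i

  sum-kronecker : ∀ {n} (p : Fin n) (f : V n) → sum (λ i → kronecker p i * f i) ≈ f p
  sum-kronecker zero f = begin
    1# * f zero + sum (λ i → 0# * f (suc i))             ≈⟨ +-cong (*-identityˡ _) (sum-zero (λ i → zeroˡ (f (suc i)))) ⟩
    f zero + 0#                                          ≈⟨ +-identityʳ _ ⟩
    f zero                                               ∎
  sum-kronecker (suc p) f = begin
    0# * f zero + sum (λ i → kronecker p i * f (suc i))  ≈⟨ +-cong (zeroˡ _) (sum-kronecker p (f ∘ suc)) ⟩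
    0# + f (suc p)                                       ≈⟨ +-identityˡ _ ⟩
    f (suc p)                                            ∎

  lincomb-+kronecker : ∀ {I : Set} {n} (c : Fin n → Carrier) p β (v : Fin n → I → Carrier) x →
    lincomb (λ i → c i + kronecker p i * β) v x ≈ lincomb c v x + β * v p x
  lincomb-+kronecker c p β v x = begin
    sum (λ i → (c i + kronecker p i * β) * v i x)
      ≈⟨ sum-cong-≋ (λ i → trans (distribʳ (v i x) (c i) _) (+-congˡ (*-assoc (kronecker p i) β (v i x)))) ⟩
    sum (λ i → c i * v i x + kronecker p i * (β * v i x))
      ≈⟨ ∑-distrib-+ (λ i → c i * v i x) (λ i → kronecker p i * (β * v i x)) ⟩
    lincomb c v x + sum (λ i → kronecker p i * (β * v i x))
      ≈⟨ +-congˡ (sum-kronecker p (λ i → β * v i x)) ⟩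
    lincomb c v x + β * v p x ∎

  search : ∀ {a} r (Q : Vec (Fin a) r → Set) → (∀ v → Dec (Q v)) → Dec (∃ Q)
  search zero Q Q? with Q? []
  ... | yes h = yes ([] , h)
  ... | no ¬h = no λ { ([] , h) → ¬h h }
  search (suc r) Q Q? with FinP.any? (λ i → search r (λ v → Q (i ∷ v)) (λ v → Q? (i ∷ v)))
  ... | yes (i , v , h) = yes (i ∷ v , h)
  ... | no ¬h = no λ { (i ∷ v , h) → ¬h (i , v , h) }

  Invariant : ∀ {r} → ((Fin r → Carrier) → Set) → Set
  Invariant Q = ∀ {c c'} → (∀ i → c i ≈ c' i) → Q c → Q c'

  enumerated : ∀ {r} → Vec (Fin q) r → Fin r → Carrier
  enumerated w i = enum (lookup w i)

  encode : ∀ {r} → (Fin r → Carrier) → Vec (Fin q) r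
  encode c = tabulate (λ i → proj₁ (enum-sur (c i)))

  enumerated-encode : ∀ {r} (c : Fin r → Carrier) i → enumerated (encode c) i ≈ c i
  enumerated-encode c i = trans (reflexive (P.cong enum (VecP.lookup∘tabulate _ i))) (proj₂ (enum-sur (c i)))

  coeffs? : ∀ r (Q : (Fin r → Carrier) → Set) → Invariant Q → (∀ c → Dec (Q c)) → Dec (∃ Q)
  coeffs? r Q inv Q? with search r (Q ∘ enumerated) (Q? ∘ enumerated)
  ... | yes (w , h) = yes (_ , h)
  ... | no none = no λ (c , h) → none (encode c , inv (λ i → sym (enumerated-encode c i)) h)

  lincomb-cong : ∀ {I : Set} {r} {c c' : Fin r → Carrier} {v v' : Fin r → I → Carrier} →
    (∀ i → c i ≈ c' i) → (∀ i x → v i x ≈ v' i x) → ∀ x → lincomb c v x ≈ lincomb c' v' x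
  lincomb-cong c≈c' v≈v' x = sum-cong-≋ (λ i → *-cong (c≈c' i) (v≈v' i x))

  LinIndep-cong : ∀ {I : Set} {r} {v v' : Fin r → I → Carrier} →
    (∀ i x → v i x ≈ v' i x) → LinIndep v → LinIndep v'
  LinIndep-cong v≈v' li c H = li c (λ x → trans (lincomb-cong (λ _ → refl) v≈v' x) (H x))

  -- Linear independence of finitely many vectors in F^m is decidable: search for a nontrivial relation.
  LinIndep? : ∀ {r m} (v : Fin r → V m) → Dec (LinIndep v)
  LinIndep? {r} v with coeffs? r Relation relation-invariant
      (λ c → FinP.all? (λ x → lincomb c v x ≟F 0#) ×-dec ¬? (FinP.all? (λ i → c i ≟F 0#)))
    where
    Relation : (Fin r → Carrier) → Set
    Relation c = (∀ x → lincomb c v x ≈ 0#) × ¬ (∀ i → c i ≈ 0#)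
    relation-invariant : Invariant Relation
    relation-invariant c≈c' (H , nz) =
      (λ x → trans (sym (lincomb-cong {v = v} {v' = v} c≈c' (λ _ _ → refl) x)) (H x)) ,
      (λ z → nz (λ i → trans (c≈c' i) (z i)))
  ... | yes (c , H , nz) = no λ li → nz (li c H)
  ... | no none = yes λ c H → decidable-stable (FinP.all? (λ i → c i ≟F 0#)) (λ nz → none (c , H , nz))

  LinIndep-nonzero : ∀ {I : Set} {r} {v : Fin r → I → Carrier} → LinIndep v → ∀ l → ¬ (∀ x → v l x ≈ 0#)
  LinIndep-nonzero {v = v} li l zero-row =
    1≉0 (trans (reflexive (P.sym (kronecker-diag l))) (li (kronecker l) (λ x → trans (sum-kronecker l (λ i → v i x)) (zero-row x)) l))

  IndepRows : ∀ {k m} → Mat k m → ℕ → Set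
  IndepRows {k} M r = Σ (Fin r → Fin k) λ s → Injective _≡_ _≡_ s × LinIndep (M ∘ s)

  IndepRows? : ∀ {k m} (M : Mat k m) r → Dec (IndepRows M r)
  IndepRows? {k} M r with search r (λ w → InjectiveLookup w × LinIndep (M ∘ lookup w))
      (λ w → FinP.all? (λ i → FinP.all? (λ j → (lookup w i FinP.≟ lookup w j) →-dec (i FinP.≟ j)))
             ×-dec LinIndep? (M ∘ lookup w))
    where
    InjectiveLookup : Vec (Fin k) r → Set
    InjectiveLookup w = ∀ i j → lookup w i ≡ lookup w j → i ≡ j
  ... | yes (w , inj , li) = yes (lookup w , (λ {i} {j} → inj i j) , li)
  ... | no none = no λ (s , inj , li) →
    let s≡ : ∀ i → lookup (tabulate s) i ≡ s i
        s≡ = VecP.lookup∘tabulate s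
    in none (tabulate s , (λ i j e → inj (P.trans (P.sym (s≡ i)) (P.trans e (s≡ j))))
                        , LinIndep-cong (λ i x → reflexive (P.cong (λ z → M z x) (P.sym (s≡ i)))) li)

  largest-indep : ∀ {k m} (M : Mat k m) b →
    Σ ℕ λ r → IndepRows M r × (∀ r' → r' ℕ.≤ b → IndepRows M r' → r' ℕ.≤ r)
  largest-indep M zero = 0 , ((λ ()) , (λ {i} → ⊥-elim (FinP.¬Fin0 i)) , λ c H ()) , λ { _ z≤n _ → z≤n }
  largest-indep M (suc b) with IndepRows? M (suc b)
  ... | yes indep = suc b , indep , λ r' r'≤ _ → r'≤
  ... | no ¬indep with largest-indep M b
  ... | r , indep , largest = r , indep , below
    where
    below : ∀ r' → r' ℕ.≤ suc b → IndepRows M r' → r' ℕ.≤ r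
    below r' r'≤ indep' with ℕP.m≤n⇒m<n∨m≡n r'≤
    ... | inj₁ r'<  = largest r' (ℕP.≤-pred r'<) indep'
    ... | inj₂ P.refl = ⊥-elim (¬indep indep')

  -- Every matrix has a rank (independent rows are injectively indexed, so at most k of them).
  rank : ∀ {k m} (M : Mat k m) → Σ ℕ (IsRank M)
  rank {k} M with largest-indep M k
  ... | r , indep , largest = r , indep , λ r' s inj li → largest r' (FinP.injective⇒≤ inj) (s , inj , li)

  rank-unique : ∀ {k m} {M : Mat k m} {r r'} → IsRank M r → IsRank M r' → r ≡ r'
  rank-unique ((s , inj , li) , max) ((s' , inj' , li') , max') = ℕP.≤-antisym (max' _ s inj li) (max _ s' inj' li')

  rank-cong : ∀ {k m} {M M' : Mat k m} {r} → M ≈ₘ M' → IsRank M r → IsRank M' r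
  rank-cong M≈M' ((s , inj , li) , max) =
    (s , inj , LinIndep-cong (λ i x → M≈M' (s i) x) li) ,
    λ r' s' inj' li' → max r' s' inj' (LinIndep-cong (λ i x → sym (M≈M' (s' i) x)) li')

  LinIndep-neg : ∀ {I : Set} {r} {v : Fin r → I → Carrier} → LinIndep v → LinIndep (λ i x → - v i x)
  LinIndep-neg {v = v} li c H i = -‿injective (trans (li (λ i → - c i) negated-relation i) (sym -0#≈0#))
    where
    negated-relation : ∀ x → lincomb (λ i → - c i) v x ≈ 0#
    negated-relation x = trans (sum-cong-≋ (λ i → trans (sym (-‿distribˡ-* (c i) (v i x))) (-‿distribʳ-* (c i) (v i x)))) (H x)

  dist-sym : ∀ {k m} {M N : Mat k m} {r} → IsDist M N r → IsDist N M r
  dist-sym {M = M} {N} ((s , inj , li) , max) =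
    (s , inj , LinIndep-cong (λ i x → ⁻¹-anti-homo‿- (M (s i) x) (N (s i) x)) (LinIndep-neg li)) ,
    λ r' s' inj' li' → max r' s' inj'
      (LinIndep-cong (λ i x → ⁻¹-anti-homo‿- (N (s' i) x) (M (s' i) x)) (LinIndep-neg li'))

  -- If every nonzero row of M is indexed by the image of g : Fin p → Fin k, then rk M ≤ p:
  -- independent rows are nonzero, so they inject into Fin p.
  rank≤rows : ∀ {k m p} (M : Mat k m) (g : Fin p → Fin k) →
    (∀ i → (∃ λ x → g x ≡ i) ⊎ (∀ j → M i j ≈ 0#)) → ∀ {r} → IsRank M r → r ℕ.≤ p
  rank≤rows {p = p} M g rows ((s , s-inj , li) , _) = FinP.injective⇒≤ {f = proj₁ ∘ preimage} preimage-inj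
    where
    preimage : ∀ l → ∃ λ x → g x ≡ s l
    preimage l with rows (s l)
    ... | inj₁ pre      = pre
    ... | inj₂ zero-row = ⊥-elim (LinIndep-nonzero li l zero-row)
    preimage-inj : Injective _≡_ _≡_ (proj₁ ∘ preimage)
    preimage-inj {l} {l'} e =
      s-inj (P.trans (P.sym (proj₂ (preimage l))) (P.trans (P.cong g e) (proj₂ (preimage l'))))

  dot : ∀ {N} → V N → V N → Carrier
  dot y v = sum (λ j → y j * v j)

  dot-comm : ∀ {N} (x y : V N) → dot x y ≈ dot y x
  dot-comm x y = sum-cong-≋ (λ j → *-comm (x j) (y j))

  Span : ∀ {n N} → (Fin n → V N) → Set
  Span {n} {N} u = ∀ (x : V N) → ∃ λ (c : Fin n → Carrier) → ∀ j → lincomb c u j ≈ x j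

  Ann : ∀ {n N} → (Fin n → V N) → Set
  Ann {n} {N} u = ∃ λ (y : V N) → ¬ (∀ j → y j ≈ 0#) × (∀ i → dot y (u i) ≈ 0#)

  -- One step of Gaussian elimination. The p-th vector of u has invertible first coordinate
  -- (u p 0 · ai = 1); subtracting multiples of w = ai · u p clears the first coordinate of every
  -- vector, leaving the family `reduced` in F^N.
  module Pivot {N n} (u : Fin n → V (suc N)) (p : Fin n) (ai : Carrier) (inverse-pivot : u p zero * ai ≈ 1#) where
    w : V (suc N)
    w j = ai * u p j

    cancel-pivot : ∀ x → x * ai * u p zero ≈ x
    cancel-pivot x = trans (*-assoc x ai _) (trans (*-congˡ (trans (*-comm ai _) inverse-pivot)) (*-identityʳ x))

    reduced : Fin n → V N
    reduced i j = u i (suc j) - u i zero * w (suc j)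

    lincomb-reduced : ∀ {r} (c : Fin r → Carrier) (f : Fin r → Fin n) j →
      lincomb c (reduced ∘ f) j ≈ lincomb c (λ l → u (f l) ∘ suc) j - lincomb c (u ∘ f) zero * w (suc j)
    lincomb-reduced c f j = sum-sub-scaled c (λ l → u (f l) (suc j)) (λ l → u (f l) zero) (w (suc j))

    -- If the reduced family spans F^N, then u spans F^(1+N): correct the first coordinate
    -- with a multiple of the pivot vector.
    span-lift : Span reduced → Span u
    span-lift spans x = d , agrees
      where
      c : Fin n → Carrier
      c = proj₁ (spans (λ j → x (suc j) - x zero * w (suc j)))
      s = lincomb c u zero
      β = (x zero - s) * ai
      d : Fin n → Carrier
      d i = c i + kronecker p i * β
      add-pivot : ∀ j → lincomb d u j ≈ lincomb c u j + β * u p j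
      add-pivot = lincomb-+kronecker c p β u
      agrees : ∀ j → lincomb d u j ≈ x j
      agrees zero = begin
        lincomb d u zero      ≈⟨ add-pivot zero ⟩
        s + β * u p zero      ≈⟨ +-congˡ (cancel-pivot (x zero - s)) ⟩
        s + (x zero - s)      ≈⟨ +-comm s _ ⟩
        x zero - s + s        ≈⟨ //-rightDividesˡ s (x zero) ⟩
        x zero                ∎
      agrees (suc j) = begin
        lincomb d u (suc j)                       ≈⟨ add-pivot (suc j) ⟩
        T + β * u p (suc j)                       ≈⟨ +-congˡ (*-assoc (x zero - s) ai _) ⟩
        T + (x zero - s) * W                      ≈⟨ +-congˡ ([y-z]x≈yx-zx W (x zero) s) ⟩
        T + (x zero * W - s * W)                  ≈⟨ +-congˡ (+-comm _ _) ⟩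
        T + (- (s * W) + x zero * W)              ≈⟨ sym (+-assoc T _ _) ⟩
        (T - s * W) + x zero * W                  ≈⟨ +-congʳ (trans (sym (lincomb-reduced c (λ i → i) j)) (proj₂ (spans _) j)) ⟩
        (x (suc j) - x zero * W) + x zero * W     ≈⟨ //-rightDividesˡ (x zero * W) (x (suc j)) ⟩
        x (suc j)                                 ∎
        where
        T = lincomb c u (suc j)
        W = w (suc j)

    ann-lift : Ann reduced → Ann u
    ann-lift (y' , nonzero , orthogonal) = y , (λ y≈0 → nonzero (y≈0 ∘ suc)) , orthogonal-lift
      where
      E = dot y' (w ∘ suc)
      y : V (suc N)
      y zero    = - E
      y (suc j) = y' j
      dot-reduced : ∀ i → dot y' (reduced i) ≈ dot y' (λ j → u i (suc j)) - u i zero * E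
      dot-reduced i = begin
        dot y' (reduced i)
          ≈⟨ sum-cong-≋ (λ j → *-congˡ (+-congˡ (-‿cong (*-comm (u i zero) (w (suc j)))))) ⟩
        sum (λ j → y' j * (u i (suc j) - w (suc j) * u i zero))
          ≈⟨ sum-sub-scaled y' (λ j → u i (suc j)) (w ∘ suc) (u i zero) ⟩
        dot y' (λ j → u i (suc j)) - E * u i zero
          ≈⟨ +-congˡ (-‿cong (*-comm E _)) ⟩
        dot y' (λ j → u i (suc j)) - u i zero * E ∎
      orthogonal-lift : ∀ i → dot y (u i) ≈ 0#
      orthogonal-lift i = begin
        - E * u i zero + D            ≈⟨ +-congʳ (trans (sym (-‿distribˡ-* E _)) (-‿cong (*-comm E _))) ⟩
        - (u i zero * E) + D          ≈⟨ +-comm _ D ⟩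
        D - u i zero * E              ≈⟨ sym (dot-reduced i) ⟩
        dot y' (reduced i)            ≈⟨ orthogonal i ⟩
        0#                            ∎
        where
        D = dot y' (λ j → u i (suc j))

  -- Dropping the pivot vector, the reduced family of an independent family stays independent:
  -- a relation among the reduced vectors lifts to a relation among the original ones.
  indep-drop : ∀ {N r} (u : Fin (suc r) → V (suc N)) p ai (inverse-pivot : u p zero * ai ≈ 1#) →
    LinIndep u → LinIndep (Pivot.reduced u p ai inverse-pivot ∘ punchIn p)
  indep-drop {r = r} u p ai inverse-pivot li c relation l =
    trans (reflexive (P.sym (VFP.insertAt-punchIn c p β l))) (li d lifted-relation (punchIn p l))
    where
    open Pivot u p ai inverse-pivot
    S₀ = lincomb c (u ∘ punchIn p) zero
    β = - S₀ * ai
    d : Fin (suc r) → Carrier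
    d = VF.insertAt c p β
    split : ∀ x → lincomb d u x ≈ β * u p x + lincomb c (u ∘ punchIn p) x
    split x = trans (sum-remove {i = p} (λ i → d i * u i x))
      (+-cong (*-congʳ (reflexive (VFP.insertAt-lookup c p β)))
              (sum-cong-≋ (λ l → *-congʳ (reflexive (VFP.insertAt-punchIn c p β l)))))
    lifted-relation : ∀ x → lincomb d u x ≈ 0#
    lifted-relation zero = begin
      lincomb d u zero       ≈⟨ split zero ⟩
      β * u p zero + S₀      ≈⟨ +-congʳ (cancel-pivot (- S₀)) ⟩
      - S₀ + S₀              ≈⟨ -‿inverseˡ S₀ ⟩
      0#                     ∎
    lifted-relation (suc j) = begin
      lincomb d u (suc j)                 ≈⟨ split (suc j) ⟩
      β * u p (suc j) + Sⱼ                ≈⟨ +-congʳ (trans (*-assoc (- S₀) ai _) (sym (-‿distribˡ-* S₀ (w (suc j))))) ⟩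
      - (S₀ * w (suc j)) + Sⱼ             ≈⟨ +-comm _ Sⱼ ⟩
      Sⱼ - S₀ * w (suc j)                 ≈⟨ sym (lincomb-reduced c (punchIn p) j) ⟩
      lincomb c (reduced ∘ punchIn p) j   ≈⟨ relation j ⟩
      0#                                  ∎
      where
      Sⱼ = lincomb c (u ∘ punchIn p) (suc j)

  pivot? : ∀ {n N} (u : Fin n → V (suc N)) → Dec (∃ λ i → ¬ (u i zero ≈ 0#))
  pivot? u = FinP.any? (λ i → ¬? (u i zero ≟F 0#))

  no-pivot : ∀ {n N} (u : Fin n → V (suc N)) → ¬ (∃ λ i → ¬ (u i zero ≈ 0#)) → ∀ i → u i zero ≈ 0#
  no-pivot u none i = decidable-stable (u i zero ≟F 0#) (λ nz → none (i , nz))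

  span-or-ann : ∀ N {n} (u : Fin n → V N) → Span u ⊎ Ann u
  span-or-ann zero    u = inj₁ (λ x → (λ _ → 0#) , λ ())
  span-or-ann (suc N) u with pivot? u
  ... | no none = inj₂ (kronecker zero , (λ e₀≈0 → 1≉0 (e₀≈0 zero)) , λ i → trans (sum-kronecker zero (u i)) (no-pivot u none i))
  ... | yes (p , nonzero) with inverse (u p zero) nonzero
  ... | ai , inverse-pivot =
    Sum.map (Pivot.span-lift u p ai inverse-pivot) (Pivot.ann-lift u p ai inverse-pivot)
            (span-or-ann N (Pivot.reduced u p ai inverse-pivot))

  indep≤dim : ∀ N {r} (u : Fin r → V N) → LinIndep u → r ℕ.≤ N
  indep≤dim _       {zero}  u li = z≤n
  indep≤dim zero    {suc r} u li = ⊥-elim (LinIndep-nonzero {v = u} li zero (λ ()))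
  indep≤dim (suc N) {suc r} u li with pivot? u
  ... | no none = ℕP.m≤n⇒m≤1+n (indep≤dim N (λ i → u i ∘ suc) tail-indep)
    where
    -- all first coordinates vanish, so forgetting them keeps the family independent
    tail-indep : LinIndep (λ i → u i ∘ suc)
    tail-indep c relation = li c λ
      { zero    → sum-zero (λ i → trans (*-congˡ (no-pivot u none i)) (zeroʳ (c i)))
      ; (suc j) → relation j }
  ... | yes (p , nonzero) with inverse (u p zero) nonzero
  ... | ai , inverse-pivot = s≤s (indep≤dim N _ (indep-drop u p ai inverse-pivot li))

  sum-↑ : ∀ a {b} (f : V (a ℕ.+ b)) → sum f ≈ sum (λ i → f (i Fin.↑ˡ b)) + sum (λ j → f (a Fin.↑ʳ j))
  sum-↑ zero    f = sym (+-identityˡ _)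
  sum-↑ (suc a) f = trans (+-congˡ (sum-↑ a (f ∘ suc))) (sym (+-assoc _ _ _))

  sum-combine : ∀ a {m} (g : V (a ℕ.* m)) → sum g ≈ sum (λ (i : Fin a) → sum (λ (j : Fin m) → g (Fin.combine i j)))
  sum-combine zero        g = refl
  sum-combine (suc a) {m} g = trans (sum-↑ m g) (+-congˡ (sum-combine a (λ x → g (m Fin.↑ʳ x))))

  ↑-cases : ∀ a {b} (i : Fin (a ℕ.+ b)) → (∃ λ x → x Fin.↑ˡ b ≡ i) ⊎ (∃ λ y → a Fin.↑ʳ y ≡ i)
  ↑-cases a i with Fin.splitAt a i in eq
  ... | inj₁ x = inj₁ (x , FinP.splitAt⁻¹-↑ˡ eq)
  ... | inj₂ y = inj₂ (y , FinP.splitAt⁻¹-↑ʳ eq)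

  lincomb-++ : ∀ {a b N} (α : Fin (a ℕ.+ b) → Carrier) (f : Fin a → V N) (g : Fin b → V N) x →
    lincomb α (f VF.++ g) x ≈ lincomb (λ i → α (i Fin.↑ˡ b)) f x + lincomb (λ j → α (a Fin.↑ʳ j)) g x
  lincomb-++ {a} {b} α f g x = trans (sum-↑ a (λ i → α i * (f VF.++ g) i x))
    (+-cong (sum-cong-≋ (λ i → *-congˡ (reflexive (P.cong (λ h → h x) (VFP.lookup-++ˡ f g i)))))
            (sum-cong-≋ (λ j → *-congˡ (reflexive (P.cong (λ h → h x) (VFP.lookup-++ʳ f g j))))))

  dot-lincomb : ∀ {n N} (c : Fin n → Carrier) (u : Fin n → V N) (y : V N) →
    dot (lincomb c u) y ≈ sum (λ i → c i * dot (u i) y)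
  dot-lincomb c u y = begin
    sum (λ x → lincomb c u x * y x)             ≈⟨ sum-cong-≋ (λ x → *-distribʳ-sum (y x) (λ i → c i * u i x)) ⟩
    sum (λ x → sum (λ i → c i * u i x * y x))   ≈⟨ sum-cong-≋ (λ x → sum-cong-≋ (λ i → *-assoc (c i) (u i x) (y x))) ⟩
    sum (λ x → sum (λ i → c i * (u i x * y x))) ≈⟨ ∑-comm (λ x i → c i * (u i x * y x)) ⟩
    sum (λ i → sum (λ x → c i * (u i x * y x))) ≈⟨ sum-cong-≋ (λ i → sym (*-distribˡ-sum (c i) (λ x → u i x * y x))) ⟩
    sum (λ i → c i * dot (u i) y)               ∎

  -- The vectors of an independent family B admit a dual family E with ⟨Eₗ , Bᵢ⟩ = δₗᵢ:
  -- the transposed family spans, since a vector orthogonal to it is a relation among the Bᵢ.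
  dual-family : ∀ {n N} (B : Fin n → V N) → LinIndep B →
    ∃ λ (E : Fin n → V N) → ∀ l i → dot (E l) (B i) ≈ kronecker l i
  dual-family {n} {N} B independent with span-or-ann n (λ x i → B i x)
  ... | inj₁ spans = (λ l → proj₁ (spans (kronecker l))) , λ l → proj₂ (spans (kronecker l))
  ... | inj₂ (y , nonzero , relation) = ⊥-elim (nonzero (independent y relation))

  dot-+ˡ : ∀ {N} (f g y : V N) → dot (λ x → f x + g x) y ≈ dot f y + dot g y
  dot-+ˡ f g y = trans (sum-cong-≋ (λ x → distribʳ (y x) (f x) (g x))) (∑-distrib-+ (λ x → f x * y x) (λ x → g x * y x))

  -- If B' is independent and orthogonal to B, and E is dual to B, then B' followed by E is independent:
  -- pairing a relation with Bᵢ isolates the i-th coefficient of E, after which B' remains.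
  append-dual-indep : ∀ {n n' N} (B : Fin n → V N) (B' : Fin n' → V N) (E : Fin n → V N) →
    LinIndep B' → (∀ j i → dot (B' j) (B i) ≈ 0#) → (∀ l i → dot (E l) (B i) ≈ kronecker l i) →
    LinIndep (B' VF.++ E)
  append-dual-indep {n} {n'} B B' E B'-indep orthogonal dual α relation = coefficient-vanishes
    where
    a : Fin n' → Carrier
    a j = α (j Fin.↑ˡ n)
    e : Fin n → Carrier
    e l = α (n' Fin.↑ʳ l)
    split : ∀ x → lincomb α (B' VF.++ E) x ≈ lincomb a B' x + lincomb e E x
    split = lincomb-++ α B' E
    e-vanishes : ∀ i → e i ≈ 0#
    e-vanishes i = sym (begin
      0#                                     ≈⟨ sym (sum-zero (λ x → trans (*-congʳ (relation x)) (zeroˡ _))) ⟩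
      dot (lincomb α (B' VF.++ E)) (B i)     ≈⟨ sum-cong-≋ (λ x → *-congʳ (split x)) ⟩
      dot (λ x → lincomb a B' x + lincomb e E x) (B i)
                                             ≈⟨ dot-+ˡ (lincomb a B') (lincomb e E) (B i) ⟩
      dot (lincomb a B') (B i) + dot (lincomb e E) (B i)
                                             ≈⟨ +-cong (dot-lincomb a B' (B i)) (dot-lincomb e E (B i)) ⟩
      sum (λ j → a j * dot (B' j) (B i)) + sum (λ l → e l * dot (E l) (B i))
                                             ≈⟨ +-cong (sum-zero (λ j → trans (*-congˡ (orthogonal j i)) (zeroʳ _)))
                                                       (sum-cong-≋ (λ l → trans (*-congˡ (dual l i)) (*-comm _ _))) ⟩
      0# + sum (λ l → kronecker l i * e l)   ≈⟨ +-identityˡ _ ⟩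
      sum (λ l → kronecker l i * e l)        ≈⟨ reflexive (sum-cong-≗ (λ l → P.cong (_* e l) (kronecker-sym l i))) ⟩
      sum (λ l → kronecker i l * e l)        ≈⟨ sum-kronecker i e ⟩
      e i                                    ∎)
    a-vanishes : ∀ j → a j ≈ 0#
    a-vanishes = B'-indep a λ x → begin
      lincomb a B' x                  ≈⟨ sym (+-identityʳ _) ⟩
      lincomb a B' x + 0#             ≈⟨ +-congˡ (sym (sum-zero (λ l → trans (*-congʳ (e-vanishes l)) (zeroˡ _)))) ⟩
      lincomb a B' x + lincomb e E x  ≈⟨ sym (split x) ⟩
      lincomb α (B' VF.++ E) x        ≈⟨ relation x ⟩
      0#                              ∎
    coefficient-vanishes : ∀ g → α g ≈ 0#
    coefficient-vanishes g with ↑-cases n' g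
    ... | inj₁ (j , P.refl) = a-vanishes j
    ... | inj₂ (l , P.refl) = e-vanishes l

  vec : ∀ {a m} → Mat a m → V (a ℕ.* m)
  vec {a} {m} X x = X (proj₁ (Fin.remQuot {a} m x)) (proj₂ (Fin.remQuot {a} m x))

  vec-combine : ∀ {a m} (X : Mat a m) i j → vec X (Fin.combine i j) ≡ X i j
  vec-combine {a} {m} X i j = P.cong (λ (i' , j') → X i' j') (FinP.remQuot-combine {a} {m} i j)

  trMNt≈dot : ∀ {a m} (M N : Mat a m) → trMNt M N ≈ dot (vec M) (vec N)
  trMNt≈dot {a} {m} M N = sym (trans (sum-combine a (λ x → vec M x * vec N x))
    (sum-cong-≋ (λ i → sum-cong-≋ (λ j → reflexive (P.cong₂ _*_ (vec-combine M i j) (vec-combine N i j))))))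

  vec-indep : ∀ {n a m} (b : Fin n → Mat a m) → LinIndep (flat ∘ b) → LinIndep (vec ∘ b)
  vec-indep b independent c relation = independent c λ (i , j) →
    trans (reflexive (sum-cong-≗ (λ l → P.cong (c l *_) (P.sym (vec-combine (b l) i j))))) (relation (Fin.combine i j))

  -- n independent codewords and n' independent dual codewords satisfy n + n' ≤ km
  -- (so dim C + dim C⊥ ≤ km): the dual codewords together with a family dual to the
  -- codewords are km-dimensional vectors that are linearly independent.
  dim-sum≤ : ∀ {k m n n'} (C : Code k m) (b : Fin n → Mat k m) (b' : Fin n' → Mat k m) →
    (∀ i → C (b i)) → LinIndep (flat ∘ b) → (∀ j → Dual C (b' j)) → LinIndep (flat ∘ b') →
    n ℕ.+ n' ℕ.≤ k ℕ.* m
  dim-sum≤ {k} {m} {n} {n'} C b b' b∈C b-indep b'∈C⊥ b'-indep with dual-family (vec ∘ b) (vec-indep b b-indep)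
  ... | E , dual = P.subst (ℕ._≤ k ℕ.* m) (ℕP.+-comm n' n)
    (indep≤dim (k ℕ.* m) (vec ∘ b' VF.++ E) (append-dual-indep (vec ∘ b) (vec ∘ b') E (vec-indep b' b'-indep) orthogonal dual))
    where
    orthogonal : ∀ j i → dot (vec (b' j)) (vec (b i)) ≈ 0#
    orthogonal j i = trans (dot-comm (vec (b' j)) (vec (b i))) (trans (sym (trMNt≈dot (b i) (b' j))) (b'∈C⊥ j (b i) (b∈C i)))

  combination : ∀ {n k m} → (Fin n → Carrier) → (Fin n → Mat k m) → Mat k m
  combination c b a j = lincomb c (flat ∘ b) (a , j)

  Spans : ∀ {k m n} → Code k m → (Fin n → Mat k m) → Set
  Spans C b = ∀ X → C X → ∃ λ c → combination c b ≈ₘ X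

  combination∈ : ∀ {k m n} {C : Code k m} → IsLinearCode C → (b : Fin n → Mat k m) → (∀ i → C (b i)) →
    ∀ c → C (combination c b)
  combination∈ {n = zero}  linear b b∈C c = IsLinearCode.zero∈ linear
  combination∈ {n = suc n} linear b b∈C c =
    IsLinearCode.+∈ linear (IsLinearCode.·∈ linear (c zero) (b∈C zero)) (combination∈ linear (b ∘ suc) (b∈C ∘ suc) (c ∘ suc))

  zero∈Dual : ∀ {k m} (C : Code k m) → Dual C 0ₘ
  zero∈Dual C M _ = sum-zero (λ a → sum-zero (λ j → zeroʳ (M a j)))

  orthogonal⇒dual : ∀ {k m n} (C : Code k m) (b : Fin n → Mat k m) → Spans C b →
    ∀ N → (∀ l → trMNt (b l) N ≈ 0#) → Dual C N
  orthogonal⇒dual C b spans N orthogonal M M∈C = begin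
    trMNt M N                              ≈⟨ sum-cong-≋ (λ a → sum-cong-≋ (λ j → *-congʳ (sym (proj₂ (spans M M∈C) a j)))) ⟩
    trMNt (combination c b) N              ≈⟨ trMNt≈dot (combination c b) N ⟩
    dot (lincomb c (vec ∘ b)) (vec N)      ≈⟨ dot-lincomb c (vec ∘ b) (vec N) ⟩
    sum (λ l → c l * dot (vec (b l)) (vec N))
                                           ≈⟨ sum-zero (λ l → trans (*-congˡ (trans (sym (trMNt≈dot (b l) N)) (orthogonal l))) (zeroʳ (c l))) ⟩
    0#                                     ∎
    where
    c = proj₁ (spans M M∈C)

  unvec : ∀ {a m} → V (a ℕ.* m) → Mat a m
  unvec y i j = y (Fin.combine i j)

  vec-unvec : ∀ {a m} (y : V (a ℕ.* m)) x → vec {a} {m} (unvec y) x ≡ y x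
  vec-unvec {a} {m} y x = P.cong y (FinP.combine-remQuot {a} m x)

  module RowSplit (t s : ℕ) {m : ℕ} where
    top : Mat (t ℕ.+ s) m → Mat t m
    top X a = X (a Fin.↑ˡ s)

    pad : Mat t m → Mat (t ℕ.+ s) m
    pad Y = Y VF.++ (λ _ _ → 0#)

    top-vec : Mat (t ℕ.+ s) m → V (t ℕ.* m)
    top-vec X = vec {t} {m} (top X)

    trMNt-pad : ∀ (X : Mat (t ℕ.+ s) m) (Y : Mat t m) → trMNt X (pad Y) ≈ trMNt (top X) Y
    trMNt-pad X Y = begin
      trMNt X (pad Y)
        ≈⟨ sum-↑ t (λ a → sum (λ j → X a j * pad Y a j)) ⟩
      sum (λ a → sum (λ j → X (a Fin.↑ˡ s) j * pad Y (a Fin.↑ˡ s) j)) + sum (λ a → sum (λ j → X (t Fin.↑ʳ a) j * pad Y (t Fin.↑ʳ a) j))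
        ≈⟨ +-cong (reflexive (sum-cong-≗ (λ a → sum-cong-≗ (λ j → P.cong (λ row → X (a Fin.↑ˡ s) j * row j) (VFP.lookup-++ˡ Y _ a)))))
                  (sum-zero (λ a → sum-zero (λ j → trans (*-congˡ (reflexive (P.cong (λ row → row j) (VFP.lookup-++ʳ Y _ a))))
                                                         (zeroʳ (X (t Fin.↑ʳ a) j))))) ⟩
      trMNt (top X) Y + 0#
        ≈⟨ +-identityʳ _ ⟩
      trMNt (top X) Y ∎

    padded-dual : ∀ {n} (C : Code (t ℕ.+ s) m) (b : Fin n → Mat (t ℕ.+ s) m) → Spans C b →
      Ann (top-vec ∘ b) → ∃ λ N → Dual C N × (∀ a j → N (t Fin.↑ʳ a) j ≈ 0#) × ¬ (N ≈ₘ 0ₘ)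
    padded-dual C b spans (y , nonzero , orthogonal) = N , N∈C⊥ , bottom-zero , N≉0
      where
      Y : Mat t m
      Y = unvec {t} {m} y
      N : Mat (t ℕ.+ s) m
      N = pad Y
      N∈C⊥ : Dual C N
      N∈C⊥ = orthogonal⇒dual C b spans N λ l → begin
        trMNt (b l) N                        ≈⟨ trMNt-pad (b l) Y ⟩
        trMNt (top (b l)) Y                  ≈⟨ trMNt≈dot (top (b l)) Y ⟩
        dot (top-vec (b l)) (vec {t} {m} Y)  ≈⟨ reflexive (sum-cong-≗ (λ x → P.cong (top-vec (b l) x *_) (vec-unvec {t} {m} y x))) ⟩
        dot (top-vec (b l)) y                ≈⟨ dot-comm (top-vec (b l)) y ⟩
        dot y (top-vec (b l))                ≈⟨ orthogonal l ⟩
        0#                                   ∎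
      bottom-zero : ∀ a j → N (t Fin.↑ʳ a) j ≈ 0#
      bottom-zero a j = reflexive (P.cong (λ row → row j) (VFP.lookup-++ʳ Y _ a))
      N≉0 : ¬ (N ≈ₘ 0ₘ)
      N≉0 N≈0 = nonzero λ x → let (a , j) = Fin.remQuot {t} m x in begin
        y x                 ≡⟨ P.sym (vec-unvec {t} {m} y x) ⟩
        Y a j               ≡⟨ P.sym (P.cong (λ row → row j) (VFP.lookup-++ˡ Y (λ _ _ → 0#) a)) ⟩
        N (a Fin.↑ˡ s) j    ≈⟨ N≈0 (a Fin.↑ˡ s) j ⟩
        0#                  ∎

    rank≤t : ∀ (M : Mat (t ℕ.+ s) m) → (∀ a j → M (t Fin.↑ʳ a) j ≈ 0#) → ∀ {r} → IsRank M r → r ℕ.≤ t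
    rank≤t M bottom-zero = rank≤rows M (Fin._↑ˡ s) rows
      where
      rows : ∀ i → (∃ λ x → x Fin.↑ˡ s ≡ i) ⊎ (∀ j → M i j ≈ 0#)
      rows i with ↑-cases t i
      ... | inj₁ in-top         = inj₁ in-top
      ... | inj₂ (a , P.refl)   = inj₂ (bottom-zero a)

    rank≤s : ∀ (M : Mat (t ℕ.+ s) m) → (∀ a j → M (a Fin.↑ˡ s) j ≈ 0#) → ∀ {r} → IsRank M r → r ℕ.≤ s
    rank≤s M top-zero = rank≤rows M (t Fin.↑ʳ_) rows
      where
      rows : ∀ i → (∃ λ x → t Fin.↑ʳ x ≡ i) ⊎ (∀ j → M i j ≈ 0#)
      rows i with ↑-cases t i
      ... | inj₁ (a , P.refl)   = inj₂ (top-zero a)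
      ... | inj₂ in-bottom      = inj₁ in-bottom

    -- If no nonzero dual codeword vanishes on the bottom rows, then every pattern of top rows
    -- occurs in C: otherwise elimination on the top parts of a spanning family yields one.
    top-rows-onto : ∀ {n} (C : Code (t ℕ.+ s) m) → IsLinearCode C →
      (b : Fin n → Mat (t ℕ.+ s) m) → (∀ i → C (b i)) → Spans C b →
      ¬ (∃ λ N → Dual C N × (∀ a j → N (t Fin.↑ʳ a) j ≈ 0#) × ¬ (N ≈ₘ 0ₘ)) →
      ∀ X → ∃ λ M → C M × (∀ a j → M (a Fin.↑ˡ s) j ≈ X (a Fin.↑ˡ s) j)
    top-rows-onto C linear b b∈C spans no-dual X with span-or-ann (t ℕ.* m) (top-vec ∘ b)
    ... | inj₂ annihilated = ⊥-elim (no-dual (padded-dual C b spans annihilated))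
    ... | inj₁ tops-span = combination c b , combination∈ linear b b∈C c , agrees
      where
      c = proj₁ (tops-span (top-vec X))
      agrees : ∀ a j → combination c b (a Fin.↑ˡ s) j ≈ X (a Fin.↑ˡ s) j
      agrees a j = begin
        combination c b (a Fin.↑ˡ s) j            ≡⟨ sum-cong-≗ (λ l → P.cong (c l *_) (P.sym (vec-combine (top (b l)) a j))) ⟩
        lincomb c (top-vec ∘ b) (Fin.combine a j) ≈⟨ proj₂ (tops-span (top-vec X)) (Fin.combine a j) ⟩
        top-vec X (Fin.combine a j)               ≡⟨ vec-combine (top X) a j ⟩
        X (a Fin.↑ˡ s) j                          ∎

  -- Split the k = t + s rows with t < d(C⊥). A nonzero dual codeword vanishing on
  -- the bottom rows would have rank ≤ t, so there is none; hence every X agrees with some codeword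
  -- on the top t rows, and differs from it in rank at most s.
  covered-by-bottom-rows : ∀ {k m n} (t s : ℕ) → t ℕ.+ s ≡ k → (C : Code k m) → IsLinearCode C →
    (b : Fin n → Mat k m) → (∀ i → C (b i)) → Spans C b →
    ∀ δ⊥ → MinDist (Dual C) δ⊥ → t ℕ.< δ⊥ → Covers C s
  covered-by-bottom-rows t s P.refl C linear b b∈C spans δ⊥ (_ , δ⊥-least) t<δ⊥ X
    with top-rows-onto C linear b b∈C spans no-dual X
    where
    open RowSplit t s using (top-rows-onto; rank≤t)
    no-dual : ¬ (∃ λ N → Dual C N × (∀ a j → N (t Fin.↑ʳ a) j ≈ 0#) × ¬ (N ≈ₘ 0ₘ))
    no-dual (N , N∈C⊥ , bottom-zero , N≉0) = ℕP.<-irrefl P.refl (ℕP.<-≤-trans t<δ⊥ (ℕP.≤-trans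
      (δ⊥-least N 0ₘ N∈C⊥ (zero∈Dual C) N≉0 r N-rank)
      (rank≤t (N -ₘ 0ₘ) (λ a j → trans (+-congˡ -0#≈0#) (trans (+-identityʳ _) (bottom-zero a j))) N-rank)))
      where
      r = proj₁ (rank (N -ₘ 0ₘ))
      N-rank = proj₂ (rank (N -ₘ 0ₘ))
  ... | M , M∈C , agrees = M , M∈C , r , X-M-rank ,
      RowSplit.rank≤s t s (X -ₘ M) (λ a j → x≈y⇒x∙y⁻¹≈ε (sym (agrees a j))) X-M-rank
    where
    r = proj₁ (rank (X -ₘ M))
    X-M-rank = proj₂ (rank (X -ₘ M))

  minDist-unique : ∀ {k m} {C : Code k m} {δ δ'} → MinDist C δ → MinDist C δ' → δ ≡ δ'
  minDist-unique ((M , N , M∈C , N∈C , M≉N , dist) , least) ((M' , N' , M'∈C , N'∈C , M'≉N' , dist') , least') =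
    ℕP.≤-antisym (least M' N' M'∈C N'∈C M'≉N' _ dist') (least' M N M∈C N∈C M≉N _ dist)

  RankAtMost : ∀ {k m} → Mat k m → ℕ → Set
  RankAtMost M d = ∃ λ r → IsRank M r × r ℕ.≤ d

  -- Decidable, since the rank exists and is unique.
  rankAtMost? : ∀ {k m} (M : Mat k m) d → Dec (RankAtMost M d)
  rankAtMost? M d with rank M
  ... | r , r-rank with r ℕP.≤? d
  ... | yes r≤d = yes (r , r-rank , r≤d)
  ... | no  r≰d = no λ (r' , r'-rank , r'≤d) → r≰d (P.subst (ℕ._≤ d) (rank-unique {M = M} r'-rank r-rank) r'≤d)

  Far : ∀ {k m} → Code k m → ℕ → Mat k m → Set
  Far C d X = ∀ M → C M → ∀ r → IsDist X M r → d ℕ.≤ r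

  -- A matrix is within distance d of a code spanned by a finite family, or at distance > d from
  -- all of it: the codewords are finitely many combinations, so this is a finite search.
  near-or-far : ∀ {k m n} (C : Code k m) → IsLinearCode C → (b : Fin n → Mat k m) → (∀ i → C (b i)) → Spans C b →
    ∀ d X → (∃ λ M → C M × RankAtMost (X -ₘ M) d) ⊎ Far C (suc d) X
  near-or-far {n = n} C linear b b∈C spans d X
    with coeffs? n (λ c → RankAtMost (X -ₘ combination c b) d) invariant (λ c → rankAtMost? (X -ₘ combination c b) d)
    where
    invariant : Invariant (λ c → RankAtMost (X -ₘ combination c b) d)
    invariant {c} {c'} c≈c' (r , r-rank , r≤d) =
      r , rank-cong {M = X -ₘ combination c b} {M' = X -ₘ combination c' b} X-c≈X-c' r-rank , r≤d
      where
      X-c≈X-c' : (X -ₘ combination c b) ≈ₘ (X -ₘ combination c' b)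
      X-c≈X-c' a j = +-congˡ (-‿cong (lincomb-cong {v = flat ∘ b} {v' = flat ∘ b} c≈c' (λ _ _ → refl) (a , j)))
  ... | yes (c , near) = inj₁ (combination c b , combination∈ linear b b∈C c , near)
  ... | no none = inj₂ λ M M∈C r dist → decidable-stable (suc d ℕP.≤? r) λ r≱ →
    let (c , c-spans) = spans M M∈C
    in none (c , r , rank-cong {M = X -ₘ M} {M' = X -ₘ combination c b} (λ a j → +-congˡ (-‿cong (sym (c-spans a j)))) dist ,
             ℕP.≮⇒≥ r≱)

  -- If ρ(C) < d(C), C is maximal: a matrix outside C is within ρ of some codeword,
  -- so adjoining it would create a distance below d(C).
  radius<distance⇒maximal : ∀ {k m} (C : Code k m) → RespectsEq C → ∀ δ ρ → MinDist C δ → CovRad C ρ →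
    ρ ℕ.< δ → Maximal C
  radius<distance⇒maximal C resp δ ρ δ-C@((M₀ , N₀ , M₀∈C , N₀∈C , M₀≉N₀ , _) , _) (covers , _) ρ<δ =
    (M₀ , N₀ , M₀∈C , N₀∈C , M₀≉N₀) ,
    λ (D , _ , C⊆D , (X , X∈D , X∉C) , (δ' , δ'-C , δ'-D)) →
      let (M , M∈C , r , dist , r≤ρ) = covers X
          X≉M : ¬ (X ≈ₘ M)
          X≉M X≈M = X∉C (resp (λ i j → sym (X≈M i j)) M∈C)
          δ≤r : δ ℕ.≤ r
          δ≤r = P.subst (ℕ._≤ r) (minDist-unique δ'-C δ-C) (proj₂ δ'-D X M X∈D (C⊆D M M∈C) X≉M r dist)
      in ℕP.<-irrefl P.refl (ℕP.≤-<-trans r≤ρ (ℕP.<-≤-trans ρ<δ δ≤r))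

  -- If some X is at distance > d from every codeword of C, where d(C) = d + 1, then C is not
  -- maximal: adjoining X keeps the minimum distance, and X ∉ C since rk(X - X) = 0.
  far⇒¬maximal : ∀ {k m} (C : Code k m) → RespectsEq C → ∀ d X → MinDist C (suc d) → Far C (suc d) X → ¬ Maximal C
  far⇒¬maximal {k} {m} C resp d X δ-C far (_ , no-extension) =
    no-extension (D , D-resp , (λ _ → inj₁) , (X , inj₂ (λ _ _ → refl) , X∉C) , suc d , δ-C , δ-D)
    where
    D : Code k m
    D Y = C Y ⊎ (Y ≈ₘ X)
    D-resp : RespectsEq D
    D-resp Y≈Y' (inj₁ Y∈C) = inj₁ (resp Y≈Y' Y∈C)
    D-resp Y≈Y' (inj₂ Y≈X) = inj₂ (λ i j → trans (sym (Y≈Y' i j)) (Y≈X i j))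
    X∉C : ¬ C X
    X∉C X∈C = ℕP.<⇒≱ (s≤s z≤n) (ℕP.≤-trans (far X X∈C _ X-X-rank)
      (rank≤rows (X -ₘ X) (λ ()) (λ i → inj₂ (λ j → -‿inverseʳ (X i j))) X-X-rank))
      where
      X-X-rank = proj₂ (rank (X -ₘ X))
    least : ∀ M N → D M → D N → ¬ (M ≈ₘ N) → ∀ r → IsDist M N r → suc d ℕ.≤ r
    least M N (inj₁ M∈C) (inj₁ N∈C) M≉N r dist = proj₂ δ-C M N M∈C N∈C M≉N r dist
    least M N (inj₁ M∈C) (inj₂ N≈X) M≉N r dist =
      far M M∈C r (dist-sym {M = M} {N = X} (rank-cong {M = M -ₘ N} (λ i j → +-congˡ (-‿cong (N≈X i j))) dist))
    least M N (inj₂ M≈X) (inj₁ N∈C) M≉N r dist =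
      far N N∈C r (rank-cong {M = M -ₘ N} (λ i j → +-congʳ (M≈X i j)) dist)
    least M N (inj₂ M≈X) (inj₂ N≈X) M≉N r dist = ⊥-elim (M≉N (λ i j → trans (M≈X i j) (sym (N≈X i j))))
    δ-D : MinDist D (suc d)
    δ-D = (let (M , N , M∈C , N∈C , rest) = proj₁ δ-C in M , N , inj₁ M∈C , inj₁ N∈C , rest) , least

  -- If ρ(C) = d(C) = d + 1 then C is not covered at radius d, so the finite search finds a matrix
  -- at distance > d from C, which refutes maximality.
  radius≡distance⇒¬maximal : ∀ {k m n} (C : Code k m) → IsLinearCode C →
    (b : Fin n → Mat k m) → (∀ i → C (b i)) → Spans C b →
    ∀ d → MinDist C (suc d) → CovRad C (suc d) → ¬ Maximal C
  radius≡distance⇒¬maximal C linear b b∈C spans d δ-C (_ , least-radius) maximal =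
    ℕP.1+n≰n (least-radius d covered)
    where
    covered : Covers C d
    covered X = Sum.[ (λ near → near) , (λ far → ⊥-elim (far⇒¬maximal C (IsLinearCode.resp linear) d X δ-C far maximal)) ]
                (near-or-far C linear b b∈C spans d X)

open CeilingArithmetic using (free-rows≤)

corollary6p7 : (q : ℕ) → IsPrimePower q → (F : FiniteField q) →
    (k m : ℕ) → .{{_ : NonZero m}} → 0 < k → k ≤ m →
    let open Codes F in
    (C : Code k m) → IsLinearCode C →
    (n n' : ℕ) → IsDim C n → IsDim (Dual C) n' →
    DuallyQMRD C n n' →
    (δ ρ : ℕ) → MinDist C δ → CovRad C ρ →
    ρ ≤ δ × ((ρ ≡ δ) ⇔ (¬ Maximal C))
corollary6p7 q _ F k m _ _ C linear n n' (b , b∈C , b-indep , b-spans) (b' , b'∈C⊥ , b'-indep , _)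
             (_ , δ-qmrd , δ⊥-qmrd) δ ρ δ-C ρ-C =
  ρ≤δ , mk⇔ radius≡distance⇒ ¬maximal⇒radius≡distance
  where
  open Codes F
  open LinearAlgebra F
  c  = ⌈ n / m ⌉
  c' = ⌈ n' / m ⌉
  t  = k ℕ.∸ c'
  -- d(C⊥) = t + 1 > t, so C is covered at radius k - t
  ρ≤k-t : ρ ≤ k ℕ.∸ t
  ρ≤k-t = proj₂ ρ-C (k ℕ.∸ t) (covered-by-bottom-rows t (k ℕ.∸ t) (ℕP.m+[n∸m]≡n (ℕP.m∸n≤m k c'))
            C linear b b∈C b-spans (t ℕ.+ 1) δ⊥-qmrd (ℕP.m<m+n t (s≤s z≤n)))
  δ≡ : δ ≡ suc (k ℕ.∸ c)
  δ≡ = P.trans (minDist-unique δ-C δ-qmrd) (ℕP.+-comm (k ℕ.∸ c) 1)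
  -- dim C + dim C⊥ ≤ km bounds k - t by the Singleton-like value of d(C)
  ρ≤δ : ρ ≤ δ
  ρ≤δ = ℕP.≤-trans ρ≤k-t (P.subst (k ℕ.∸ t ≤_) (P.sym (minDist-unique δ-C δ-qmrd))
          (free-rows≤ k m n n' (dim-sum≤ C b b' b∈C b-indep b'∈C⊥ b'-indep)))
  radius≡distance⇒ : ρ ≡ δ → ¬ Maximal C
  radius≡distance⇒ ρ≡δ = radius≡distance⇒¬maximal C linear b b∈C b-spans (k ℕ.∸ c)
    (P.subst (MinDist C) δ≡ δ-C) (P.subst (CovRad C) (P.trans ρ≡δ δ≡) ρ-C)
  ¬maximal⇒radius≡distance : ¬ Maximal C → ρ ≡ δ
  ¬maximal⇒radius≡distance ¬maximal = decidable-stable (ρ ℕ.≟ δ) λ ρ≢δ →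
    ¬maximal (radius<distance⇒maximal C (IsLinearCode.resp linear) δ ρ δ-C ρ-C (ℕP.≤∧≢⇒< ρ≤δ ρ≢δ))
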